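{- Every $A\in\mathsf{ASM}_n(2143,3412)$ has at most $3$ entries equal to $-1$.
   Context: An alternating sign matrix (ASM) is a square matrix with entries in $\{0,1,-1\}$ such that every row and every column sums to $1$ and the nonzero entries of each row and each column alternate in sign. A permutation $\pi\in S_k$ is identified with the $k\times k$ matrix whose row $i$ has a $1$ in column $\pi(i)$ and $0$ elsewhere. An $n\times n$ ASM $A$ classically contains $\pi\in S_k$ if there are order-preserving injections $f,g:[k]\to[n]$ with $A_{f(i),g(\pi(i))}=1$ for all $i$; otherwise $A$ classically avoids $\pi$. $\mathsf{ASM}_n(2143,3412)$ is the set of $n\times n$ ASMs classically avoiding both $2143$ and $3412$. -}

module Defs where

open import Data.Nat using (ℕ)
open import Data.Fin using (Fin; zero; suc; _<_)
open import Data.Integer using (ℤ; _+_; -_; 0ℤ; 1ℤ; -1ℤ) renaming (_≟_ to _≟ℤ_)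
open import Data.List using (List; foldr; map; length; filter; cartesianProduct)
open import Data.Product using (_×_; _,_; Σ; ∃)
open import Data.Sum using (_⊎_)
open import Relation.Binary.PropositionalEquality using (_≡_; _≢_)
open import Data.List.Base using (allFin)

Matrix : ℕ → Set
Matrix n = Fin n → Fin n → ℤ

sumℤ : List ℤ → ℤ
sumℤ = foldr _+_ 0ℤ

rowSum : ∀ {n} → Matrix n → Fin n → ℤ
rowSum {n} A i = sumℤ (map (λ j → A i j) (allFin n))

colSum : ∀ {n} → Matrix n → Fin n → ℤ
colSum {n} A j = sumℤ (map (λ i → A i j) (allFin n))

Alternates : ∀ {n} → (Fin n → ℤ) → Set
Alternates {n} v =
  ∀ (j j' : Fin n) → j < j' → v j ≢ 0ℤ → v j' ≢ 0ℤ →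
  (∀ (m : Fin n) → j < m → m < j' → v m ≡ 0ℤ) →
  v j' ≡ - v j

record IsASM {n : ℕ} (A : Matrix n) : Set where
  field
    entries  : ∀ i j → (A i j ≡ 0ℤ) ⊎ ((A i j ≡ 1ℤ) ⊎ (A i j ≡ -1ℤ))
    rowSum1  : ∀ i → rowSum A i ≡ 1ℤ
    colSum1  : ∀ j → colSum A j ≡ 1ℤ
    rowAlt   : ∀ i → Alternates (λ j → A i j)
    colAlt   : ∀ j → Alternates (λ i → A i j)

OrderPreserving : ∀ {k n} → (Fin k → Fin n) → Set
OrderPreserving {k} f = ∀ (a b : Fin k) → a < b → f a < f b

-- A permutation pattern π ∈ S_k is given by its one-line notation,
-- as a map Fin k → Fin k (0-indexed): row i has its 1 in column π i.
-- Classical containment of π in A.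
Contains : ∀ {n k} → Matrix n → (Fin k → Fin k) → Set
Contains {n} {k} A π =
  Σ (Fin k → Fin n) λ f → Σ (Fin k → Fin n) λ g →
    OrderPreserving f × OrderPreserving g × (∀ i → A (f i) (g (π i)) ≡ 1ℤ)

Avoids : ∀ {n k} → Matrix n → (Fin k → Fin k) → Set
Avoids A π = Contains A π → ⊥
  where open import Data.Empty using (⊥)

-- 2143 in one-line notation (1-indexed), i.e. 0 ↦ 1, 1 ↦ 0, 2 ↦ 3, 3 ↦ 2.
p2143 : Fin 4 → Fin 4
p2143 zero = suc zero
p2143 (suc zero) = zero
p2143 (suc (suc zero)) = suc (suc (suc zero))
p2143 (suc (suc (suc zero))) = suc (suc zero)

p3412 : Fin 4 → Fin 4
p3412 zero = suc (suc zero)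
p3412 (suc zero) = suc (suc (suc zero))
p3412 (suc (suc zero)) = zero
p3412 (suc (suc (suc zero))) = suc zero

InASM-2143-3412 : ∀ {n} → Matrix n → Set
InASM-2143-3412 A = IsASM A × Avoids A p2143 × Avoids A p3412

numNegOnes : ∀ {n} → Matrix n → ℕ
numNegOnes {n} A =
  length (filter (λ p → A (Data.Product.proj₁ p) (Data.Product.proj₂ p) ≟ℤ -1ℤ)
                 (cartesianProduct (allFin n) (allFin n)))

-- The sum of an alternating sequence is 0 or its first nonzero entry, so in a row
-- or column of an ASM every -1 has a 1 on each side of it.  Hence two
-- -1 entries strictly north-west/south-east of each other yield a 2143 (take the
-- 1s above and left of the first, right of and below the second), and two strictly
-- north-east/south-west of each other yield a 3412; so any two -1 entries share
-- a row or a column, and any three distinct ones lie on one line.  Finally four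
-- -1 entries at columns j₁ < j₂ < j₃ < j₄ of one row are impossible: compare the
-- rows of the 1s below j₂ and j₃.  If they differ, the 1s around j₁ or j₄ complete
-- a 2143 or a 3412; if they coincide, that row has a -1 between j₂ and j₃, which
-- lies south-east of the -1 at j₁.  Columns follow by transposition.

module Submission where

open import Defs
open import Data.Nat using (ℕ; _≤_; z≤n; s≤s; z<s; s<s)
open import Data.Fin using (Fin; zero; suc) renaming (_<_ to _<ᶠ_; _≤_ to _≤ᶠ_)
open import Data.Fin.Properties using (<-cmp; <-trans; ≤-trans; ≤∧≢⇒<; any?; _<?_)
open import Data.Integer using (ℤ; _+_; -_; 0ℤ; 1ℤ; -1ℤ) renaming (_≟_ to _≟ℤ_)
open import Data.Integer.Properties using (neg-involutive; +-inverseʳ; +-identityˡ; +-identityʳ)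
open import Data.List using (List; []; _∷_; map; length; filter; cartesianProduct; allFin)
open import Data.List.Properties using (map-tabulate)
open import Data.List.Relation.Unary.All using (All; []; _∷_)
open import Data.List.Relation.Unary.All.Properties using (all-filter)
open import Data.List.Relation.Unary.AllPairs using ([]; _∷_)
open import Data.List.Relation.Unary.Unique.Propositional using (Unique)
open import Data.List.Relation.Unary.Unique.Propositional.Properties using (filter⁺; cartesianProduct⁺; allFin⁺)
open import Data.Product using (_×_; _,_; ∃; proj₁; proj₂)
open import Data.Sum using (_⊎_; inj₁; inj₂)
open import Data.Empty using (⊥)
open import Function using (_∘_; id)
open import Relation.Binary using (tri<; tri≈; tri>)
open import Relation.Binary.PropositionalEquality using (_≡_; _≢_; refl; sym; trans; cong; subst; module ≡-Reasoning)
open import Relation.Nullary using (¬_; yes; no; contradiction)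
open import Relation.Nullary.Decidable using (¬?; _×-dec_; decidable-stable)
open import Relation.Unary using (Decidable)

least-witness : ∀ {n} {P : Fin n → Set} → Decidable P → ∀ {j} → P j →
                ∃ λ a → a ≤ᶠ j × P a × (∀ m → m <ᶠ a → ¬ P m)
least-witness {ℕ.suc n} P? {j} pj with P? zero
... | yes p₀ = zero , z≤n , p₀ , λ _ ()
least-witness {ℕ.suc n} P? {zero} pj | no ¬p₀ = contradiction pj ¬p₀
least-witness {ℕ.suc n} {P} P? {suc j} pj | no ¬p₀ with least-witness {P = P ∘ suc} (P? ∘ suc) pj
... | a , a≤j , pa , below =
  suc a , s≤s a≤j , pa , λ { zero _ → ¬p₀ ; (suc m) (s<s m<a) → below m m<a }

greatest-witness : ∀ {n} {P : Fin n → Set} → Decidable P → ∀ {j} → P j →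
                   ∃ λ b → j ≤ᶠ b × P b × (∀ m → b <ᶠ m → ¬ P m)
greatest-witness {ℕ.suc n} {P} P? {suc j} pj with greatest-witness {P = P ∘ suc} (P? ∘ suc) pj
... | b , j≤b , pb , above = suc b , s≤s j≤b , pb , λ { (suc m) (s<s b<m) → above m b<m }
greatest-witness {ℕ.suc n} {P} P? {zero} p₀ with any? (P? ∘ suc)
... | yes (m , pm) with greatest-witness {P = P ∘ suc} (P? ∘ suc) pm
...   | b , _ , pb , above = suc b , z≤n , pb , λ { (suc m) (s<s b<m) → above m b<m }
greatest-witness {ℕ.suc n} {P} P? {zero} p₀ | no none =
  zero , z≤n , p₀ , λ { (suc m) _ pm → none (m , pm) }

nonzero? : ∀ {n} (v : Fin n → ℤ) → Decidable (λ m → v m ≢ 0ℤ)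
nonzero? v m = ¬? (v m ≟ℤ 0ℤ)

¬nonzero⇒zero : ∀ {x} → ¬ (x ≢ 0ℤ) → x ≡ 0ℤ
¬nonzero⇒zero {x} = decidable-stable (x ≟ℤ 0ℤ)

sumFin : ∀ {n} → (Fin n → ℤ) → ℤ
sumFin {n} v = sumℤ (map v (allFin n))

sumFin-suc : ∀ {n} (v : Fin (ℕ.suc n) → ℤ) → sumFin v ≡ v zero + sumFin (v ∘ suc)
sumFin-suc {n} v = cong (v zero +_) (trans (cong sumℤ (map-tabulate suc v))
                                           (sym (cong sumℤ (map-tabulate id (v ∘ suc)))))

sumFin-head-zero : ∀ {n} (v : Fin (ℕ.suc n) → ℤ) → v zero ≡ 0ℤ → sumFin v ≡ sumFin (v ∘ suc)
sumFin-head-zero v v₀≡0 = begin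
  sumFin v                  ≡⟨ sumFin-suc v ⟩
  v zero + sumFin (v ∘ suc) ≡⟨ cong (_+ sumFin (v ∘ suc)) v₀≡0 ⟩
  0ℤ + sumFin (v ∘ suc)     ≡⟨ +-identityˡ _ ⟩
  sumFin (v ∘ suc)          ∎
  where open ≡-Reasoning

sumFin-zero : ∀ {n} (v : Fin n → ℤ) → (∀ m → v m ≡ 0ℤ) → sumFin v ≡ 0ℤ
sumFin-zero {ℕ.zero} v _ = refl
sumFin-zero {ℕ.suc n} v v≡0 = trans (sumFin-head-zero v (v≡0 zero)) (sumFin-zero (v ∘ suc) (v≡0 ∘ suc))

Alternates-tail : ∀ {n} (v : Fin (ℕ.suc n) → ℤ) → Alternates v → Alternates (v ∘ suc)
Alternates-tail v alt j j' j<j' vj vj' between =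
  alt (suc j) (suc j') (s<s j<j') vj vj' λ { (suc m) (s<s j<m) (s<s m<j') → between m j<m m<j' }

alternating-sum : ∀ {n} (v : Fin n → ℤ) → Alternates v → ∀ {a b} → a ≤ᶠ b →
                  v a ≢ 0ℤ → v b ≢ 0ℤ →
                  (∀ m → m <ᶠ a → v m ≡ 0ℤ) → (∀ m → b <ᶠ m → v m ≡ 0ℤ) →
                  (sumFin v ≡ 0ℤ × v b ≡ - v a) ⊎ (sumFin v ≡ v a × v b ≡ v a)
alternating-sum {ℕ.suc n} v alt {zero} {zero} _ _ _ _ above = inj₂ (sum≡head , refl)
  where
  open ≡-Reasoning
  sum≡head : sumFin v ≡ v zero
  sum≡head = begin
    sumFin v                  ≡⟨ sumFin-suc v ⟩
    v zero + sumFin (v ∘ suc) ≡⟨ cong (v zero +_) (sumFin-zero (v ∘ suc) (λ m → above (suc m) z<s)) ⟩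
    v zero + 0ℤ               ≡⟨ +-identityʳ _ ⟩
    v zero                    ∎
alternating-sum {ℕ.suc n} v alt {zero} {suc b} _ v₀ vb _ above
  with least-witness (nonzero? (v ∘ suc)) vb
... | f , f≤b , vf , before-f
  with alternating-sum (v ∘ suc) (Alternates-tail v alt) f≤b vf vb
         (λ m m<f → ¬nonzero⇒zero (before-f m m<f)) (λ m b<m → above (suc m) (s<s b<m))
     | alt zero (suc f) z<s v₀ vf (λ { (suc m) _ (s<s m<f) → ¬nonzero⇒zero (before-f m m<f) })
... | inj₁ (tail≡0 , vb≡-vf) | vf≡-v₀ =
  inj₂ ( trans (sumFin-suc v) (trans (cong (v zero +_) tail≡0) (+-identityʳ _))
       , trans vb≡-vf (trans (cong -_ vf≡-v₀) (neg-involutive _)) )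
... | inj₂ (tail≡vf , vb≡vf) | vf≡-v₀ =
  inj₁ ( trans (sumFin-suc v) (trans (cong (v zero +_) (trans tail≡vf vf≡-v₀)) (+-inverseʳ (v zero)))
       , trans vb≡vf vf≡-v₀ )
alternating-sum {ℕ.suc n} v alt {suc a} {suc b} (s≤s a≤b) va vb below above
  with alternating-sum (v ∘ suc) (Alternates-tail v alt) a≤b va vb
         (λ m m<a → below (suc m) (s<s m<a)) (λ m b<m → above (suc m) (s<s b<m))
... | inj₁ (tail≡0 , last) = inj₁ (trans (sumFin-head-zero v (below zero z<s)) tail≡0 , last)
... | inj₂ (tail≡va , last) = inj₂ (trans (sumFin-head-zero v (below zero z<s)) tail≡va , last)

-1≢0 : -1ℤ ≢ 0ℤ
-1≢0 ()

1≢0 : 1ℤ ≢ 0ℤ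
1≢0 ()

1≢-1 : 1ℤ ≢ -1ℤ
1≢-1 ()

flanked-by-ones : ∀ {n} (v : Fin n → ℤ) → Alternates v → sumFin v ≡ 1ℤ → ∀ {j} → v j ≡ -1ℤ →
                  (∃ λ a → a <ᶠ j × v a ≡ 1ℤ) × (∃ λ b → j <ᶠ b × v b ≡ 1ℤ)
flanked-by-ones v alt sum≡1 {j} vj≡-1
  with least-witness (nonzero? v) vj≢0 | greatest-witness (nonzero? v) vj≢0
  where
  vj≢0 : v j ≢ 0ℤ
  vj≢0 = -1≢0 ∘ trans (sym vj≡-1)
... | a , a≤j , va , before | b , j≤b , vb , after
  with alternating-sum v alt (≤-trans a≤j j≤b) va vb
         (λ m m<a → ¬nonzero⇒zero (before m m<a)) (λ m b<m → ¬nonzero⇒zero (after m b<m))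
... | inj₁ (sum≡0 , _) = contradiction (trans (sym sum≡1) sum≡0) 1≢0
... | inj₂ (sum≡va , vb≡va) =
  (a , ≤∧≢⇒< a≤j (λ a≡j → 1≢-1 (trans (sym va≡1) (trans (cong v a≡j) vj≡-1))) , va≡1) ,
  (b , ≤∧≢⇒< j≤b (λ j≡b → 1≢-1 (trans (sym vb≡1) (trans (cong v (sym j≡b)) vj≡-1))) , vb≡1)
  where
  va≡1 : v a ≡ 1ℤ
  va≡1 = trans (sym sum≡va) sum≡1
  vb≡1 : v b ≡ 1ℤ
  vb≡1 = trans vb≡va va≡1

-1-between-ones : ∀ {n} (v : Fin n → ℤ) → Alternates v → ∀ {x y} → x <ᶠ y →
                  v x ≡ 1ℤ → v y ≡ 1ℤ → ∃ λ m → x <ᶠ m × m <ᶠ y × v m ≡ -1ℤ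
-1-between-ones v alt {x} {y} x<y vx≡1 vy≡1
  with least-witness (λ m → (x <? m) ×-dec nonzero? v m) (x<y , 1≢0 ∘ trans (sym vy≡1))
... | m , m≤y , (x<m , vm) , before = m , x<m , ≤∧≢⇒< m≤y m≢y , vm≡-1
  where
  vm≡-1 : v m ≡ -1ℤ
  vm≡-1 = trans (alt x m x<m (1≢0 ∘ trans (sym vx≡1)) vm
                  (λ k x<k k<m → ¬nonzero⇒zero (λ vk → before k k<m (x<k , vk))))
                (cong -_ vx≡1)
  m≢y : m ≢ y
  m≢y m≡y = 1≢-1 (trans (sym vy≡1) (trans (cong v (sym m≡y)) vm≡-1))

transpose : ∀ {n} → Matrix n → Matrix n
transpose A i j = A j i

IsASM-transpose : ∀ {n} {A : Matrix n} → IsASM A → IsASM (transpose A)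
IsASM-transpose asm = record
  { entries = λ i j → entries j i
  ; rowSum1 = colSum1
  ; colSum1 = rowSum1
  ; rowAlt  = colAlt
  ; colAlt  = rowAlt
  }
  where open IsASM asm

transpose-contains : ∀ {n k} (A : Matrix n) (π : Fin k → Fin k) → (∀ i → π (π i) ≡ i) →
                     Contains (transpose A) π → Contains A π
transpose-contains A π π-involutive (f , g , f-mono , g-mono , hits) =
  g , f , g-mono , f-mono , λ i → subst (λ z → A (g z) (f (π i)) ≡ 1ℤ) (π-involutive i) (hits (π i))

p2143-involutive : ∀ i → p2143 (p2143 i) ≡ i
p2143-involutive zero = refl
p2143-involutive (suc zero) = refl
p2143-involutive (suc (suc zero)) = refl
p2143-involutive (suc (suc (suc zero))) = refl

p3412-involutive : ∀ i → p3412 (p3412 i) ≡ i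
p3412-involutive zero = refl
p3412-involutive (suc zero) = refl
p3412-involutive (suc (suc zero)) = refl
p3412-involutive (suc (suc (suc zero))) = refl

quadruple : ∀ {n} → Fin n → Fin n → Fin n → Fin n → Fin 4 → Fin n
quadruple x₀ x₁ x₂ x₃ zero = x₀
quadruple x₀ x₁ x₂ x₃ (suc zero) = x₁
quadruple x₀ x₁ x₂ x₃ (suc (suc zero)) = x₂
quadruple x₀ x₁ x₂ x₃ (suc (suc (suc zero))) = x₃

quadruple-increasing : ∀ {n} {x₀ x₁ x₂ x₃ : Fin n} → x₀ <ᶠ x₁ → x₁ <ᶠ x₂ → x₂ <ᶠ x₃ →
                       OrderPreserving (quadruple x₀ x₁ x₂ x₃)
quadruple-increasing p q r zero (suc zero) _ = p
quadruple-increasing p q r zero (suc (suc zero)) _ = <-trans p q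
quadruple-increasing p q r zero (suc (suc (suc zero))) _ = <-trans p (<-trans q r)
quadruple-increasing p q r (suc zero) (suc (suc zero)) _ = q
quadruple-increasing p q r (suc zero) (suc (suc (suc zero))) _ = <-trans q r
quadruple-increasing p q r (suc (suc zero)) (suc (suc (suc zero))) _ = r
quadruple-increasing p q r zero zero ()
quadruple-increasing p q r (suc _) zero ()
quadruple-increasing p q r (suc zero) (suc zero) (s<s ())
quadruple-increasing p q r (suc (suc zero)) (suc zero) (s<s ())
quadruple-increasing p q r (suc (suc zero)) (suc (suc zero)) (s<s (s<s ()))
quadruple-increasing p q r (suc (suc (suc zero))) (suc zero) (s<s ())
quadruple-increasing p q r (suc (suc (suc zero))) (suc (suc zero)) (s<s (s<s ()))
quadruple-increasing p q r (suc (suc (suc zero))) (suc (suc (suc zero))) (s<s (s<s (s<s ())))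

module _ {n} (A : Matrix n) {r₀ r₁ r₂ r₃ c₀ c₁ c₂ c₃ : Fin n}
         (r₀₁ : r₀ <ᶠ r₁) (r₁₂ : r₁ <ᶠ r₂) (r₂₃ : r₂ <ᶠ r₃)
         (c₀₁ : c₀ <ᶠ c₁) (c₁₂ : c₁ <ᶠ c₂) (c₂₃ : c₂ <ᶠ c₃) where

  contains-2143 : A r₀ c₁ ≡ 1ℤ → A r₁ c₀ ≡ 1ℤ → A r₂ c₃ ≡ 1ℤ → A r₃ c₂ ≡ 1ℤ → Contains A p2143
  contains-2143 e₀ e₁ e₂ e₃ =
    quadruple r₀ r₁ r₂ r₃ , quadruple c₀ c₁ c₂ c₃ ,
    quadruple-increasing r₀₁ r₁₂ r₂₃ , quadruple-increasing c₀₁ c₁₂ c₂₃ ,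
    λ { zero → e₀ ; (suc zero) → e₁ ; (suc (suc zero)) → e₂ ; (suc (suc (suc zero))) → e₃ }

  contains-3412 : A r₀ c₂ ≡ 1ℤ → A r₁ c₃ ≡ 1ℤ → A r₂ c₀ ≡ 1ℤ → A r₃ c₁ ≡ 1ℤ → Contains A p3412
  contains-3412 e₀ e₁ e₂ e₃ =
    quadruple r₀ r₁ r₂ r₃ , quadruple c₀ c₁ c₂ c₃ ,
    quadruple-increasing r₀₁ r₁₂ r₂₃ , quadruple-increasing c₀₁ c₁₂ c₂₃ ,
    λ { zero → e₀ ; (suc zero) → e₁ ; (suc (suc zero)) → e₂ ; (suc (suc (suc zero))) → e₃ }

module ASM-2143-3412 {n} {A : Matrix n} (asm : IsASM A)
                     (avoids-2143 : Avoids A p2143) (avoids-3412 : Avoids A p3412) where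
  open IsASM asm

  Neg : Fin n → Fin n → Set
  Neg i j = A i j ≡ -1ℤ

  one-left : ∀ {i j} → Neg i j → ∃ λ a → a <ᶠ j × A i a ≡ 1ℤ
  one-left {i} = proj₁ ∘ flanked-by-ones (A i) (rowAlt i) (rowSum1 i)

  one-right : ∀ {i j} → Neg i j → ∃ λ b → j <ᶠ b × A i b ≡ 1ℤ
  one-right {i} = proj₂ ∘ flanked-by-ones (A i) (rowAlt i) (rowSum1 i)

  one-above : ∀ {i j} → Neg i j → ∃ λ c → c <ᶠ i × A c j ≡ 1ℤ
  one-above {j = j} = proj₁ ∘ flanked-by-ones (λ i → A i j) (colAlt j) (colSum1 j)

  one-below : ∀ {i j} → Neg i j → ∃ λ d → i <ᶠ d × A d j ≡ 1ℤ
  one-below {j = j} = proj₂ ∘ flanked-by-ones (λ i → A i j) (colAlt j) (colSum1 j)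

  no-increasing-pair : ∀ {i j i' j'} → Neg i j → Neg i' j' → i <ᶠ i' → j <ᶠ j' → ⊥
  no-increasing-pair e e' i<i' j<j' =
    let (c , c<i , U) = one-above e
        (a , a<j , L) = one-left e
        (b , j'<b , R) = one-right e'
        (d , i'<d , D) = one-below e'
    in avoids-2143 (contains-2143 A c<i i<i' i'<d a<j j<j' j'<b U L R D)

  no-decreasing-pair : ∀ {i j i' j'} → Neg i j → Neg i' j' → i <ᶠ i' → j' <ᶠ j → ⊥
  no-decreasing-pair e e' i<i' j'<j =
    let (c , c<i , U) = one-above e
        (b , j<b , R) = one-right e
        (a , a<j' , L) = one-left e'
        (d , i'<d , D) = one-below e'
    in avoids-3412 (contains-3412 A c<i i<i' i'<d a<j' j'<j j<b U R L D)

  no-four-in-row : ∀ {i j₁ j₂ j₃ j₄} → j₁ <ᶠ j₂ → j₂ <ᶠ j₃ → j₃ <ᶠ j₄ →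
                   Neg i j₁ → Neg i j₂ → Neg i j₃ → Neg i j₄ → ⊥
  no-four-in-row j₁₂ j₂₃ j₃₄ e₁ e₂ e₃ e₄
    with one-below e₂ | one-below e₃
  ... | d₂ , i<d₂ , D₂ | d₃ , i<d₃ , D₃ with <-cmp d₂ d₃
  ... | tri< d₂<d₃ _ _ =
    let (c , c<i , U) = one-above e₄
        (b , j₄<b , R) = one-right e₄
    in avoids-3412 (contains-3412 A c<i i<d₂ d₂<d₃ j₂₃ j₃₄ j₄<b U R D₂ D₃)
  ... | tri> _ _ d₃<d₂ =
    let (c , c<i , U) = one-above e₁
        (a , a<j₁ , L) = one-left e₁
    in avoids-2143 (contains-2143 A c<i i<d₃ d₃<d₂ a<j₁ j₁₂ j₂₃ U L D₃ D₂)
  ... | tri≈ _ refl _ =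
    let (m , j₂<m , _ , Dm) = -1-between-ones (A d₂) (rowAlt d₂) j₂₃ D₂ D₃
    in no-increasing-pair e₁ Dm i<d₂ (<-trans j₁₂ j₂<m)

  neg-ones-share-line : ∀ {i j i' j'} → Neg i j → Neg i' j' → i ≡ i' ⊎ j ≡ j'
  neg-ones-share-line {i} {j} {i'} {j'} e e' with <-cmp i i' | <-cmp j j'
  ... | tri≈ _ i≡i' _ | _ = inj₁ i≡i'
  ... | _ | tri≈ _ j≡j' _ = inj₂ j≡j'
  ... | tri< i<i' _ _ | tri< j<j' _ _ = contradiction (no-increasing-pair e e' i<i' j<j') λ ()
  ... | tri< i<i' _ _ | tri> _ _ j'<j = contradiction (no-decreasing-pair e e' i<i' j'<j) λ ()
  ... | tri> _ _ i'<i | tri< j<j' _ _ = contradiction (no-decreasing-pair e' e i'<i j<j') λ ()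
  ... | tri> _ _ i'<i | tri> _ _ j'<j = contradiction (no-increasing-pair e' e i'<i j'<j) λ ()

AtMostThree : ∀ {X : Set} → (X → Set) → Set
AtMostThree {X} P = ∀ (a b c d : X) → P a → P b → P c → P d →
                    a ≢ b → a ≢ c → a ≢ d → b ≢ c → b ≢ d → c ≢ d → ⊥

Unique-length≤3 : ∀ {X : Set} {P : X → Set} {xs : List X} →
                  AtMostThree P → Unique xs → All P xs → length xs ≤ 3
Unique-length≤3 {xs = []} _ _ _ = z≤n
Unique-length≤3 {xs = _ ∷ []} _ _ _ = s≤s z≤n
Unique-length≤3 {xs = _ ∷ _ ∷ []} _ _ _ = s≤s (s≤s z≤n)
Unique-length≤3 {xs = _ ∷ _ ∷ _ ∷ []} _ _ _ = s≤s (s≤s (s≤s z≤n))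
Unique-length≤3 {xs = a ∷ b ∷ c ∷ d ∷ _} ≤3
  ((a≢b ∷ a≢c ∷ a≢d ∷ _) ∷ (b≢c ∷ b≢d ∷ _) ∷ (c≢d ∷ _) ∷ _) (pa ∷ pb ∷ pc ∷ pd ∷ _) =
  contradiction (≤3 a b c d pa pb pc pd a≢b a≢c a≢d b≢c b≢d c≢d) λ ()

module _ {n} {Q : Fin n → Set}
         (no-chain : ∀ {a b c d} → a <ᶠ b → b <ᶠ c → c <ᶠ d → Q a → Q b → Q c → Q d → ⊥) where

  private
    insert₃ : ∀ {a b c} → a <ᶠ b → b <ᶠ c → Q a → Q b → Q c →
              ∀ w → Q w → w ≢ a → w ≢ b → w ≢ c → ⊥
    insert₃ {a} {b} {c} a<b b<c qa qb qc w qw w≢a w≢b w≢c with <-cmp w a | <-cmp w b | <-cmp w c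
    ... | tri≈ _ w≡a _ | _ | _ = w≢a w≡a
    ... | _ | tri≈ _ w≡b _ | _ = w≢b w≡b
    ... | _ | _ | tri≈ _ w≡c _ = w≢c w≡c
    ... | tri< w<a _ _ | _ | _ = no-chain w<a a<b b<c qw qa qb qc
    ... | tri> _ _ a<w | tri< w<b _ _ | _ = no-chain a<w w<b b<c qa qw qb qc
    ... | _ | tri> _ _ b<w | tri< w<c _ _ = no-chain a<b b<w w<c qa qb qw qc
    ... | _ | _ | tri> _ _ c<w = no-chain a<b b<c c<w qa qb qc qw

    insert₂ : ∀ {a b} → a <ᶠ b → Q a → Q b → ∀ w x → Q w → Q x →
              w ≢ a → w ≢ b → x ≢ a → x ≢ b → x ≢ w → ⊥
    insert₂ {a} {b} a<b qa qb w x qw qx w≢a w≢b x≢a x≢b x≢w with <-cmp w a | <-cmp w b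
    ... | tri≈ _ w≡a _ | _ = w≢a w≡a
    ... | _ | tri≈ _ w≡b _ = w≢b w≡b
    ... | tri< w<a _ _ | _ = insert₃ w<a a<b qw qa qb x qx x≢w x≢a x≢b
    ... | tri> _ _ a<w | tri< w<b _ _ = insert₃ a<w w<b qa qw qb x qx x≢a x≢w x≢b
    ... | _ | tri> _ _ b<w = insert₃ a<b b<w qa qb qw x qx x≢a x≢b x≢w

  no-4-chain⇒AtMostThree : AtMostThree Q
  no-4-chain⇒AtMostThree a b c d qa qb qc qd a≢b a≢c a≢d b≢c b≢d c≢d with <-cmp a b
  ... | tri< a<b _ _ = insert₂ a<b qa qb c d qc qd (a≢c ∘ sym) (b≢c ∘ sym) (a≢d ∘ sym) (b≢d ∘ sym) (c≢d ∘ sym)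
  ... | tri≈ _ a≡b _ = a≢b a≡b
  ... | tri> _ _ b<a = insert₂ b<a qb qa c d qc qd (b≢c ∘ sym) (a≢c ∘ sym) (b≢d ∘ sym) (a≢d ∘ sym) (c≢d ∘ sym)

module _ {X Y : Set} {N : X × Y → Set}
         (share-line : ∀ {p q} → N p → N q → proj₁ p ≡ proj₁ q ⊎ proj₂ p ≡ proj₂ q) where

  private
    third-in-row : ∀ x x' x'' y y' y'' → N (x , y) → N (x' , y') → N (x'' , y'') →
                   y ≢ y' → x ≡ x' → x'' ≡ x
    third-in-row _ _ _ _ _ _ p q r y≢y' x≡x' with share-line p r | share-line q r
    ... | inj₁ x≡x'' | _ = sym x≡x''
    ... | _ | inj₁ x'≡x'' = trans (sym x'≡x'') (sym x≡x')
    ... | inj₂ y≡y'' | inj₂ y'≡y'' = contradiction (trans y≡y'' (sym y'≡y'')) y≢y'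

    third-in-column : ∀ x x' x'' y y' y'' → N (x , y) → N (x' , y') → N (x'' , y'') →
                      x ≢ x' → y ≡ y' → y'' ≡ y
    third-in-column _ _ _ _ _ _ p q r x≢x' y≡y' with share-line p r | share-line q r
    ... | inj₂ y≡y'' | _ = sym y≡y''
    ... | _ | inj₂ y'≡y'' = trans (sym y'≡y'') (sym y≡y')
    ... | inj₁ x≡x'' | inj₁ x'≡x'' = contradiction (trans x≡x'' (sym x'≡x'')) x≢x'

  collinear-AtMostThree : (∀ x → AtMostThree (λ y → N (x , y))) → (∀ y → AtMostThree (λ x → N (x , y))) →
                          AtMostThree N
  collinear-AtMostThree rows columns (x₁ , y₁) (x₂ , y₂) (x₃ , y₃) (x₄ , y₄) n₁ n₂ n₃ n₄ d₁₂ d₁₃ d₁₄ d₂₃ d₂₄ d₃₄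
    with share-line n₁ n₂
  ... | inj₁ refl
    with third-in-row x₁ x₁ x₃ y₁ y₂ y₃ n₁ n₂ n₃ (d₁₂ ∘ cong (x₁ ,_)) refl
       | third-in-row x₁ x₁ x₄ y₁ y₂ y₄ n₁ n₂ n₄ (d₁₂ ∘ cong (x₁ ,_)) refl
  ... | refl | refl = rows x₁ y₁ y₂ y₃ y₄ n₁ n₂ n₃ n₄
        (d₁₂ ∘ cong (x₁ ,_)) (d₁₃ ∘ cong (x₁ ,_)) (d₁₄ ∘ cong (x₁ ,_))
        (d₂₃ ∘ cong (x₁ ,_)) (d₂₄ ∘ cong (x₁ ,_)) (d₃₄ ∘ cong (x₁ ,_))
  collinear-AtMostThree rows columns (x₁ , y₁) (x₂ , y₂) (x₃ , y₃) (x₄ , y₄) n₁ n₂ n₃ n₄ d₁₂ d₁₃ d₁₄ d₂₃ d₂₄ d₃₄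
    | inj₂ refl
    with third-in-column x₁ x₂ x₃ y₁ y₁ y₃ n₁ n₂ n₃ (d₁₂ ∘ cong (_, y₁)) refl
       | third-in-column x₁ x₂ x₄ y₁ y₁ y₄ n₁ n₂ n₄ (d₁₂ ∘ cong (_, y₁)) refl
  ... | refl | refl = columns y₁ x₁ x₂ x₃ x₄ n₁ n₂ n₃ n₄
        (d₁₂ ∘ cong (_, y₁)) (d₁₃ ∘ cong (_, y₁)) (d₁₄ ∘ cong (_, y₁))
        (d₂₃ ∘ cong (_, y₁)) (d₂₄ ∘ cong (_, y₁)) (d₃₄ ∘ cong (_, y₁))

neg-ones-AtMostThree : ∀ {n} {A : Matrix n} → InASM-2143-3412 A →
                       AtMostThree (λ (p : Fin n × Fin n) → A (proj₁ p) (proj₂ p) ≡ -1ℤ)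
neg-ones-AtMostThree {A = A} (asm , avoids-2143 , avoids-3412) =
  collinear-AtMostThree M.neg-ones-share-line
    (λ _ → no-4-chain⇒AtMostThree M.no-four-in-row)
    (λ _ → no-4-chain⇒AtMostThree Mᵀ.no-four-in-row)
  where
  module M = ASM-2143-3412 asm avoids-2143 avoids-3412
  module Mᵀ = ASM-2143-3412 (IsASM-transpose asm)
                (avoids-2143 ∘ transpose-contains A p2143 p2143-involutive)
                (avoids-3412 ∘ transpose-contains A p3412 p3412-involutive)

lemma5p2 : (n : ℕ) (A : Matrix n) → InASM-2143-3412 A → numNegOnes A ≤ 3
lemma5p2 n A A∈ASM =
  Unique-length≤3 (neg-ones-AtMostThree A∈ASM)
    (filter⁺ is-neg-one? (cartesianProduct⁺ (allFin⁺ n) (allFin⁺ n)))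
    (all-filter is-neg-one? (cartesianProduct (allFin n) (allFin n)))
  where
  is-neg-one? : Decidable (λ (p : Fin n × Fin n) → A (proj₁ p) (proj₂ p) ≡ -1ℤ)
  is-neg-one? p = A (proj₁ p) (proj₂ p) ≟ℤ -1ℤ
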